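{- Let $p$ be a prime, $n,m\ge1$, and $a_1,\dots,a_n,b_1,\dots,b_m\ge0$ integers. If $\prod_{i=1}^na_i^{a_i}=\prod_{j=1}^mb_j^{b_j}$ in $\mathbb{Z}$ (with the convention $0^0=1$), then $\sum_{i=1}^n\partial_p(a_i)=\sum_{j=1}^m\partial_p(b_j)$ in $\mathbb{Z}/p\mathbb{Z}$.
   Context: For $a\in\mathbb{Z}$, $\partial_p(a)=\frac{a-a^p}{p}\in\mathbb{Z}$, regarded as an element of $\mathbb{Z}/p\mathbb{Z}$. -}

module Defs where

open import Data.Nat as ℕ using (ℕ; NonZero; _^_)
open import Data.Integer as ℤ using (ℤ; +_; _-_)
open import Data.Integer.DivMod using (_/ℕ_)
open import Data.Fin using (Fin)
open import Data.Fin.Base using () renaming (zero to fzero)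

-- Fermat quotient-type operator ∂_p(a) = (a - a^p)/p (an exact division, for a ≥ 0).
-- Note: Agda's ℕ exponentiation has 0 ^ 0 = 1, and here p ≥ 1 anyway.
∂ : (p : ℕ) → .{{NonZero p}} → ℕ → ℤ
∂ p a = (+ a - + (a ^ p)) /ℕ p

-- Π_{i} a_i ^ a_i  (with 0^0 = 1, which is ℕ._^_'s convention)
selfPowProd : {n : ℕ} → (Fin n → ℕ) → ℕ
selfPowProd {ℕ.zero} a = 1
selfPowProd {ℕ.suc n} a = (a fzero ^ a fzero) ℕ.* selfPowProd (λ i → a (Data.Fin.suc i))

sumℤ : {n : ℕ} → (Fin n → ℤ) → ℤ
sumℤ {ℕ.zero} f = + 0
sumℤ {ℕ.suc n} f = f fzero ℤ.+ sumℤ (λ i → f (Data.Fin.suc i))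

{-# OPTIONS --safe #-}
module Submission where

-- Write D(a) = a - a^p = p·∂_p(a). By Fermat p ∣ D(a), and the exact identity
-- D(ab) + D(a)D(b) = b·D(a) + a·D(b) makes D a derivation modulo p², with
-- D(p) ≡ p. Such a derivation has a logarithmic derivative S ≡ D(N)/N on
-- positive integers: for N = p^v·U with p ∤ U it is determined modulo p² by
-- U·S ≡ v·U + D(U). It turns products into sums and equals D(a) at N = a^a,
-- so equal products Π a_i^{a_i} = Π b_j^{b_j} give Σ D(a_i) ≡ Σ D(b_j)
-- modulo p², that is Σ ∂_p(a_i) ≡ Σ ∂_p(b_j) modulo p.

import Algebra.Definitions.RawSemiring as RawSemiring
import Algebra.Properties.CommutativeSemiring.Binomial as Binomial
import Algebra.Properties.CommutativeSemiring.Exp as CommutativeSemiringExp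
import Algebra.Properties.Semiring.Sum as SemiringSum
open import Data.Fin as Fin using (Fin; toℕ; inject₁)
import Data.Fin.Properties as Fin
open import Data.Integer using (ℤ; +_; _+_; _*_; _-_; -_; ∣_∣)
open import Data.Integer.DivMod using (_/ℕ_; _%ℕ_)
import Data.Integer.DivMod as ℤ
open import Data.Integer.Divisibility using (_∣_)
import Data.Integer.Divisibility.Signed as ℤ
import Data.Integer.Properties as ℤ
open import Data.Integer.Tactic.RingSolver using (solve-∀)
open import Data.Nat as ℕ using (ℕ; zero; suc; NonZero; NonTrivial; _≥_)
open import Data.Nat.Combinatorics using (_C_; nCk+nC[k+1]≡[n+1]C[k+1]; nC1≡n; nCn≡1)
open import Data.Nat.Divisibility using (quotient)
import Data.Nat.Divisibility as ℕ
import Data.Nat.Induction as ℕ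
open import Data.Nat.Primality using (Prime; euclidsLemma; prime⇒nonZero; prime⇒nonTrivial)
import Data.Nat.Properties as ℕ
import Data.Nat.Tactic.RingSolver as ℕ
open import Data.Product using (_,_; _×_; proj₁; proj₂)
open import Data.Sum using (inj₁; inj₂; [_,_]′)
import Data.Vec.Functional as Vector
open import Function using (_∘_; id)
open import Induction.WellFounded using (Acc; acc)
open import Level using (0ℓ)
open import Relation.Binary.Bundles using (Setoid)
open import Relation.Binary.PropositionalEquality
open import Relation.Binary.Structures using (IsEquivalence)
open import Relation.Nullary using (yes; no)
open import Relation.Nullary.Negation using (contradiction)

open import Defs using (∂; selfPowProd; sumℤ)

infix 4 _≡_mod_
record _≡_mod_ (x y n : ℤ) : Set where
  constructor ∣⇒≡-mod
  field ≡-mod⇒∣ : n ℤ.∣ x - y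

open _≡_mod_ public

module _ {n : ℤ} where

  ≡⇒≡-mod : ∀ {x y} → x ≡ y → x ≡ y mod n
  ≡⇒≡-mod {x} refl = ∣⇒≡-mod (ℤ.divides (+ 0) (ℤ.+-inverseʳ x))

  ≡-mod-sym : ∀ {x y} → x ≡ y mod n → y ≡ x mod n
  ≡-mod-sym {x} {y} (∣⇒≡-mod n∣x-y) = ∣⇒≡-mod (subst (n ℤ.∣_) (negate x y) (ℤ.∣m⇒∣-m n∣x-y))
    where
    negate : ∀ x y → - (x - y) ≡ y - x
    negate = solve-∀

  ≡-mod-trans : ∀ {x y z} → x ≡ y mod n → y ≡ z mod n → x ≡ z mod n
  ≡-mod-trans {x} {y} {z} (∣⇒≡-mod n∣x-y) (∣⇒≡-mod n∣y-z) =
    ∣⇒≡-mod (subst (n ℤ.∣_) (telescope x y z) (ℤ.∣m∣n⇒∣m+n n∣x-y n∣y-z))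
    where
    telescope : ∀ x y z → (x - y) + (y - z) ≡ x - z
    telescope = solve-∀

  ≡-mod-isEquivalence : IsEquivalence (λ x y → x ≡ y mod n)
  ≡-mod-isEquivalence = record { refl = ≡⇒≡-mod refl ; sym = ≡-mod-sym ; trans = ≡-mod-trans }

  +-cong-mod : ∀ {x x′ y y′} → x ≡ x′ mod n → y ≡ y′ mod n → x + y ≡ x′ + y′ mod n
  +-cong-mod {x} {x′} {y} {y′} (∣⇒≡-mod n∣x-x′) (∣⇒≡-mod n∣y-y′) =
    ∣⇒≡-mod (subst (n ℤ.∣_) (regroup x y x′ y′) (ℤ.∣m∣n⇒∣m+n n∣x-x′ n∣y-y′))
    where
    regroup : ∀ x y x′ y′ → (x - x′) + (y - y′) ≡ (x + y) - (x′ + y′)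
    regroup = solve-∀

  +-congˡ-mod : ∀ c {x y} → x ≡ y mod n → c + x ≡ c + y mod n
  +-congˡ-mod c = +-cong-mod (≡⇒≡-mod {c} refl)

  *-congˡ-mod : ∀ c {x y} → x ≡ y mod n → c * x ≡ c * y mod n
  *-congˡ-mod c {x} {y} (∣⇒≡-mod n∣x-y) = ∣⇒≡-mod (subst (n ℤ.∣_) (distrib c x y) (ℤ.∣n⇒∣m*n c n∣x-y))
    where
    distrib : ∀ c x y → c * (x - y) ≡ c * x - c * y
    distrib = solve-∀

  ∣⇒≡0-mod : ∀ {x} → n ℤ.∣ x → x ≡ + 0 mod n
  ∣⇒≡0-mod {x} n∣x = ∣⇒≡-mod (subst (n ℤ.∣_) (sym (ℤ.+-identityʳ x)) n∣x)

  n∣y⇒x≡x+y-mod : ∀ {x y} → n ℤ.∣ y → x ≡ x + y mod n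
  n∣y⇒x≡x+y-mod {x} {y} n∣y = ∣⇒≡-mod (subst (n ℤ.∣_) (difference x y) (ℤ.∣m⇒∣-m n∣y))
    where
    difference : ∀ x y → - y ≡ x - (x + y)
    difference = solve-∀

≡-mod-setoid : ℤ → Setoid 0ℓ 0ℓ
≡-mod-setoid n = record { isEquivalence = ≡-mod-isEquivalence {n} }

*-pres-∣ : ∀ {m n x y} → m ℤ.∣ x → n ℤ.∣ y → m * n ℤ.∣ x * y
*-pres-∣ {m} {n} {x} {y} m∣x n∣y = ℤ.∣-trans (ℤ.*-monoʳ-∣ m n∣y) (ℤ.*-monoˡ-∣ y m∣x)

∣∧<⇒≡0 : ∀ {d r} → d ℕ.∣ r → r ℕ.< d → r ≡ 0
∣∧<⇒≡0 {r = zero}  _   _   = refl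
∣∧<⇒≡0 {r = suc r} d∣r r<d = contradiction d∣r (ℕ.>⇒∤ r<d)

∣⇒n≡[n/ℕd]*d : ∀ {n d} .{{_ : NonZero d}} → + d ℤ.∣ n → n ≡ n /ℕ d * + d
∣⇒n≡[n/ℕd]*d {n} {d} d∣n = begin
  n                          ≡⟨ division ⟩
  + (n %ℕ d) + n /ℕ d * + d  ≡⟨ cong (λ r → + r + n /ℕ d * + d) (∣∧<⇒≡0 d∣remainder (ℤ.n%ℕd<d n d)) ⟩
  + 0 + n /ℕ d * + d         ≡⟨ ℤ.+-identityˡ (n /ℕ d * + d) ⟩
  n /ℕ d * + d               ∎
  where
  open ≡-Reasoning
  division : n ≡ + (n %ℕ d) + n /ℕ d * + d
  division = ℤ.a≡a%ℕn+[a/ℕn]*n n d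
  cancel : ∀ r x → r + x - x ≡ r
  cancel = solve-∀
  d∣remainder : d ℕ.∣ n %ℕ d
  d∣remainder = ℤ.∣⇒∣ᵤ (subst (+ d ℤ.∣_)
    (trans (cong (_- n /ℕ d * + d) division) (cancel (+ (n %ℕ d)) (n /ℕ d * + d)))
    (ℤ.∣m∣n⇒∣m-n d∣n (ℤ.∣n⇒∣m*n (n /ℕ d) ℤ.∣-refl)))

*-distribˡ-sumℤ : ∀ c {n} (f g : Fin n → ℤ) → (∀ i → f i ≡ c * g i) → sumℤ f ≡ c * sumℤ g
*-distribˡ-sumℤ c {zero}  f g f≡cg = sym (ℤ.*-zeroʳ c)
*-distribˡ-sumℤ c {suc n} f g f≡cg = begin
  f Fin.zero + sumℤ (f ∘ Fin.suc)
    ≡⟨ cong₂ _+_ (f≡cg Fin.zero) (*-distribˡ-sumℤ c (f ∘ Fin.suc) (g ∘ Fin.suc) (f≡cg ∘ Fin.suc)) ⟩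
  c * g Fin.zero + c * sumℤ (g ∘ Fin.suc)
    ≡⟨ ℤ.*-distribˡ-+ c (g Fin.zero) (sumℤ (g ∘ Fin.suc)) ⟨
  c * sumℤ g ∎
  where open ≡-Reasoning

d∣a⇒d*d∣aⁿ : ∀ {d a n} → 1 ℕ.< n → d ℕ.∣ a → d ℕ.* d ℕ.∣ a ℕ.^ n
d∣a⇒d*d∣aⁿ {n = 1} (ℕ.s≤s ()) _
d∣a⇒d*d∣aⁿ {d} {a} {suc (suc n)} _ d∣a = ℕ.∣-trans (ℕ.*-pres-∣ d∣a d∣a) (ℕ.*-monoʳ-∣ a (ℕ.m∣m*n (a ℕ.^ n)))

d∣k*dᵏ : ∀ d k → d ℕ.∣ k ℕ.* d ℕ.^ k
d∣k*dᵏ d zero    = d ℕ.∣0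
d∣k*dᵏ d (suc k) = ℕ.∣n⇒∣m*n (suc k) (ℕ.m∣m*n (d ℕ.^ k))

d*d∣k*dᵏ⁺¹ : ∀ d k → d ℕ.* d ℕ.∣ k ℕ.* d ℕ.^ suc k
d*d∣k*dᵏ⁺¹ d k = subst (d ℕ.* d ℕ.∣_) (swap d k (d ℕ.^ k)) (ℕ.*-monoʳ-∣ d (d∣k*dᵏ d k))
  where
  swap : ∀ d k x → d ℕ.* (k ℕ.* x) ≡ k ℕ.* (d ℕ.* x)
  swap = ℕ.solve-∀

[k+1]*[n+1]C[k+1]≡[n+1]*nCk : ∀ n k → suc k ℕ.* (suc n C suc k) ≡ suc n ℕ.* (n C k)
[k+1]*[n+1]C[k+1]≡[n+1]*nCk n       zero    =
  trans (ℕ.*-identityˡ _) (trans (nC1≡n (suc n)) (sym (ℕ.*-identityʳ (suc n))))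
[k+1]*[n+1]C[k+1]≡[n+1]*nCk zero    (suc k) = ℕ.*-zeroʳ (2 ℕ.+ k)
[k+1]*[n+1]C[k+1]≡[n+1]*nCk (suc n) (suc k) = begin
  (2 ℕ.+ k) ℕ.* (suc (suc n) C suc (suc k))
    ≡⟨ cong ((2 ℕ.+ k) ℕ.*_) (nCk+nC[k+1]≡[n+1]C[k+1] (suc n) (suc k)) ⟨
  (2 ℕ.+ k) ℕ.* (A ℕ.+ B)
    ≡⟨ ℕ.*-distribˡ-+ (2 ℕ.+ k) A B ⟩
  A ℕ.+ suc k ℕ.* A ℕ.+ (2 ℕ.+ k) ℕ.* B
    ≡⟨ cong₂ (λ u v → A ℕ.+ u ℕ.+ v)
         ([k+1]*[n+1]C[k+1]≡[n+1]*nCk n k) ([k+1]*[n+1]C[k+1]≡[n+1]*nCk n (suc k)) ⟩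
  A ℕ.+ suc n ℕ.* (n C k) ℕ.+ suc n ℕ.* (n C suc k)
    ≡⟨ ℕ.+-assoc A _ _ ⟩
  A ℕ.+ (suc n ℕ.* (n C k) ℕ.+ suc n ℕ.* (n C suc k))
    ≡⟨ cong (A ℕ.+_) (ℕ.*-distribˡ-+ (suc n) (n C k) (n C suc k)) ⟨
  A ℕ.+ suc n ℕ.* (n C k ℕ.+ n C suc k)
    ≡⟨ cong (λ u → A ℕ.+ suc n ℕ.* u) (nCk+nC[k+1]≡[n+1]C[k+1] n k) ⟩
  (2 ℕ.+ n) ℕ.* A ∎
  where
  open ≡-Reasoning
  A B : ℕ
  A = suc n C suc k
  B = suc n C suc (suc k)

prime∣pC[k+1] : ∀ {p k} → Prime p → suc k ℕ.< p → p ℕ.∣ p C suc k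
prime∣pC[k+1] {suc n} {k} p-prime k+1<p with euclidsLemma (suc k) (suc n C suc k) p-prime p∣[k+1]*pC[k+1]
  where
  p∣[k+1]*pC[k+1] : suc n ℕ.∣ suc k ℕ.* (suc n C suc k)
  p∣[k+1]*pC[k+1] = ℕ.divides (n C k) (trans ([k+1]*[n+1]C[k+1]≡[n+1]*nCk n k) (ℕ.*-comm (suc n) (n C k)))
... | inj₁ p∣k+1     = contradiction p∣k+1 (ℕ.>⇒∤ k+1<p)
... | inj₂ p∣pC[k+1] = p∣pC[k+1]

module ℕ-Binomial = Binomial ℕ.+-*-commutativeSemiring
module ℕ-Exp = CommutativeSemiringExp ℕ.+-*-commutativeSemiring
module ℕ-Sum = SemiringSum ℕ.+-*-semiring
open RawSemiring ℕ.+-*-rawSemiring using () renaming (_×_ to _×ₛ_; _^_ to _^ₛ_)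

×ₛ≡* : ∀ n x → n ×ₛ x ≡ n ℕ.* x
×ₛ≡* zero    x = refl
×ₛ≡* (suc n) x = cong (x ℕ.+_) (×ₛ≡* n x)

^ₛ≡^ : ∀ x n → x ^ₛ n ≡ x ℕ.^ n
^ₛ≡^ x zero    = refl
^ₛ≡^ x (suc n) = cong (x ℕ.*_) (^ₛ≡^ x n)

^-distribʳ-* : ∀ a b n → (a ℕ.* b) ℕ.^ n ≡ a ℕ.^ n ℕ.* b ℕ.^ n
^-distribʳ-* a b n =
  trans (sym (^ₛ≡^ (a ℕ.* b) n)) (trans (ℕ-Exp.^-distrib-* a b n) (cong₂ ℕ._*_ (^ₛ≡^ a n) (^ₛ≡^ b n)))

∣-sum : ∀ {d n} (f : Vector.Vector ℕ n) → (∀ i → d ℕ.∣ f i) → d ℕ.∣ ℕ-Sum.sum f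
∣-sum {n = zero}  f d∣f = _ ℕ.∣0
∣-sum {n = suc n} f d∣f = ℕ.∣m∣n⇒∣m+n (d∣f Fin.zero) (∣-sum (Vector.tail f) (d∣f ∘ Fin.suc))

freshmansDream : ∀ {p} → Prime p → ∀ x y → + ((x ℕ.+ y) ℕ.^ p) ≡ + (x ℕ.^ p) + + (y ℕ.^ p) mod + p
freshmansDream {suc n} p-prime x y = ∣⇒≡-mod (subst (+ p ℤ.∣_) difference (ℤ.∣ᵤ⇒∣ p∣inner))
  where
  p : ℕ
  p = suc n
  term : Fin (suc p) → ℕ
  term = ℕ-Binomial.binomialTerm x y p
  inner : Fin n → ℕ
  inner = Vector.init (Vector.tail term)
  p∣inner : p ℕ.∣ ℕ-Sum.sum inner
  p∣inner = ∣-sum inner λ i → subst (p ℕ.∣_) (sym (×ₛ≡* (p C suc (toℕ (inject₁ i))) _))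
    (ℕ.∣m⇒∣m*n _ (prime∣pC[k+1] p-prime (ℕ.s<s (Fin.inject₁ℕ< i))))
  first : term Fin.zero ≡ y ℕ.^ p
  first = trans (×ₛ≡* 1 _) (trans (ℕ.*-identityˡ _) (trans (ℕ.*-identityˡ _) (^ₛ≡^ y p)))
  last : Vector.last (Vector.tail term) ≡ x ℕ.^ p
  last rewrite Fin.toℕ-fromℕ n | nCn≡1 p | ℕ.n∸n≡0 n =
    trans (×ₛ≡* 1 _) (trans (ℕ.*-identityˡ _) (trans (ℕ.*-identityʳ _) (^ₛ≡^ x p)))
  expansion : (x ℕ.+ y) ℕ.^ p ≡ y ℕ.^ p ℕ.+ (ℕ-Sum.sum inner ℕ.+ x ℕ.^ p)
  expansion = begin
    (x ℕ.+ y) ℕ.^ p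
      ≡⟨ ^ₛ≡^ (x ℕ.+ y) p ⟨
    (x ℕ.+ y) ^ₛ p
      ≡⟨ ℕ-Binomial.theorem p x y ⟩
    term Fin.zero ℕ.+ ℕ-Sum.sum (Vector.tail term)
      ≡⟨ cong₂ ℕ._+_ first (ℕ-Sum.sum-init-last (Vector.tail term)) ⟩
    y ℕ.^ p ℕ.+ (ℕ-Sum.sum inner ℕ.+ Vector.last (Vector.tail term))
      ≡⟨ cong (λ z → y ℕ.^ p ℕ.+ (ℕ-Sum.sum inner ℕ.+ z)) last ⟩
    y ℕ.^ p ℕ.+ (ℕ-Sum.sum inner ℕ.+ x ℕ.^ p) ∎
    where open ≡-Reasoning
  cancel : ∀ X Y I → Y + (I + X) - (X + Y) ≡ I
  cancel = solve-∀
  difference : + ℕ-Sum.sum inner ≡ + ((x ℕ.+ y) ℕ.^ p) - (+ (x ℕ.^ p) + + (y ℕ.^ p))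
  difference = begin
    + ℕ-Sum.sum inner
      ≡⟨ cancel (+ (x ℕ.^ p)) (+ (y ℕ.^ p)) (+ ℕ-Sum.sum inner) ⟨
    + (y ℕ.^ p) + (+ ℕ-Sum.sum inner + + (x ℕ.^ p)) - (+ (x ℕ.^ p) + + (y ℕ.^ p))
      ≡⟨ cong (_- (+ (x ℕ.^ p) + + (y ℕ.^ p))) (trans (ℤ.pos-+ (y ℕ.^ p) _)
           (cong (λ z → + (y ℕ.^ p) + z) (ℤ.pos-+ (ℕ-Sum.sum inner) (x ℕ.^ p)))) ⟨
    + (y ℕ.^ p ℕ.+ (ℕ-Sum.sum inner ℕ.+ x ℕ.^ p)) - (+ (x ℕ.^ p) + + (y ℕ.^ p))
      ≡⟨ cong (λ z → + z - (+ (x ℕ.^ p) + + (y ℕ.^ p))) expansion ⟨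
    + ((x ℕ.+ y) ℕ.^ p) - (+ (x ℕ.^ p) + + (y ℕ.^ p)) ∎
    where open ≡-Reasoning

fermatsLittleTheorem : ∀ {p} → Prime p → ∀ a → + a ≡ + (a ℕ.^ p) mod + p
fermatsLittleTheorem {suc n} p-prime zero    = ≡⇒≡-mod refl
fermatsLittleTheorem {p}     p-prime (suc a) = begin
  + suc a                    ≈⟨ +-congˡ-mod (+ 1) (fermatsLittleTheorem p-prime a) ⟩
  + 1 + + (a ℕ.^ p)          ≡⟨ cong (λ z → + z + + (a ℕ.^ p)) (ℕ.^-zeroˡ p) ⟨
  + (1 ℕ.^ p) + + (a ℕ.^ p)  ≈⟨ freshmansDream p-prime 1 a ⟨
  + (suc a ℕ.^ p)            ∎
  where open import Relation.Binary.Reasoning.Setoid (≡-mod-setoid (+ p))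

p∂ : ℕ → ℕ → ℤ
p∂ p a = + a - + (a ℕ.^ p)

p∂-0 : ∀ p → .{{NonZero p}} → p∂ p 0 ≡ + 0
p∂-0 (suc _) = refl

p∂-1 : ∀ p → p∂ p 1 ≡ + 0
p∂-1 p = cong (λ z → + 1 - + z) (ℕ.^-zeroˡ p)

p∂-* : ∀ p a b → p∂ p (a ℕ.* b) + p∂ p a * p∂ p b ≡ + b * p∂ p a + + a * p∂ p b
p∂-* p a b = begin
  p∂ p (a ℕ.* b) + p∂ p a * p∂ p b
    ≡⟨ cong₂ (λ u v → u - v + p∂ p a * p∂ p b) (ℤ.pos-* a b)
         (trans (cong +_ (^-distribʳ-* a b p)) (ℤ.pos-* (a ℕ.^ p) (b ℕ.^ p))) ⟩
  + a * + b - + (a ℕ.^ p) * + (b ℕ.^ p) + p∂ p a * p∂ p b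
    ≡⟨ expand (+ a) (+ b) (+ (a ℕ.^ p)) (+ (b ℕ.^ p)) ⟩
  + b * p∂ p a + + a * p∂ p b ∎
  where
  open ≡-Reasoning
  expand : ∀ A B Aᵖ Bᵖ → A * B - Aᵖ * Bᵖ + (A - Aᵖ) * (B - Bᵖ) ≡ B * (A - Aᵖ) + A * (B - Bᵖ)
  expand = solve-∀

module _ {p : ℕ} (p-prime : Prime p) where

  private instance
    p≢0 : NonZero p
    p≢0 = prime⇒nonZero p-prime
    p≢1 : NonTrivial p
    p≢1 = prime⇒nonTrivial p-prime

  p>1 : 1 ℕ.< p
  p>1 = ℕ.nonTrivial⇒n>1 p

  p∤1 : p ℕ.∤ 1
  p∤1 p∣1 = ℕ.<⇒≢ p>1 (sym (ℕ.∣1⇒≡1 p∣1))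

  p∤u∧p∣u*w⇒p∣w : ∀ {u w} → p ℕ.∤ u → p ℕ.∣ u ℕ.* w → p ℕ.∣ w
  p∤u∧p∣u*w⇒p∣w {u} {w} p∤u p∣uw = [ (λ p∣u → contradiction p∣u p∤u) , id ]′ (euclidsLemma u w p-prime p∣uw)

  ∤-* : ∀ {x y} → p ℕ.∤ x → p ℕ.∤ y → p ℕ.∤ x ℕ.* y
  ∤-* p∤x p∤y p∣xy = p∤y (p∤u∧p∣u*w⇒p∣w p∤x p∣xy)

  ∤-^ : ∀ {x} → p ℕ.∤ x → ∀ n → p ℕ.∤ x ℕ.^ n
  ∤-^ p∤x zero    = p∤1
  ∤-^ p∤x (suc n) = ∤-* p∤x (∤-^ p∤x n)

  p∤u∧p²∣u*w⇒p²∣w : ∀ {u w} → p ℕ.∤ u → p ℕ.* p ℕ.∣ u ℕ.* w → p ℕ.* p ℕ.∣ w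
  p∤u∧p²∣u*w⇒p²∣w {u} {w} p∤u p²∣uw with p∤u∧p∣u*w⇒p∣w p∤u (ℕ.∣-trans (ℕ.m∣m*n p) p²∣uw)
  ... | ℕ.divides q refl with p∤u∧p∣u*w⇒p∣w p∤u (ℕ.*-cancelʳ-∣ p p²∣uq*p)
    where
    p²∣uq*p : p ℕ.* p ℕ.∣ u ℕ.* q ℕ.* p
    p²∣uq*p = subst (p ℕ.* p ℕ.∣_) (sym (ℕ.*-assoc u q p)) p²∣uw
  ... | ℕ.divides r refl = ℕ.divides r (ℕ.*-assoc r p p)

  record Factorisation (N : ℕ) : Set where
    field
      valuation unit : ℕ
      N≡pᵛ*unit : N ≡ p ℕ.^ valuation ℕ.* unit
      p∤unit : p ℕ.∤ unit

  factorisation-1 : Factorisation 1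
  factorisation-1 = record { valuation = 0 ; unit = 1 ; N≡pᵛ*unit = refl ; p∤unit = p∤1 }

  factorisation-p : Factorisation p
  factorisation-p = record
    { valuation = 1 ; unit = 1 ; N≡pᵛ*unit = sym (trans (ℕ.*-identityʳ _) (ℕ.*-identityʳ p)) ; p∤unit = p∤1 }

  factorisation-* : ∀ {M N} → Factorisation M → Factorisation N → Factorisation (M ℕ.* N)
  factorisation-* {M} {N} f g = record
    { valuation = F.valuation ℕ.+ G.valuation
    ; unit = F.unit ℕ.* G.unit
    ; N≡pᵛ*unit = begin
        M ℕ.* N
          ≡⟨ cong₂ ℕ._*_ F.N≡pᵛ*unit G.N≡pᵛ*unit ⟩
        p ℕ.^ F.valuation ℕ.* F.unit ℕ.* (p ℕ.^ G.valuation ℕ.* G.unit)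
          ≡⟨ interchange (p ℕ.^ F.valuation) F.unit (p ℕ.^ G.valuation) G.unit ⟩
        p ℕ.^ F.valuation ℕ.* p ℕ.^ G.valuation ℕ.* (F.unit ℕ.* G.unit)
          ≡⟨ cong (ℕ._* (F.unit ℕ.* G.unit)) (ℕ.^-distribˡ-+-* p F.valuation G.valuation) ⟨
        p ℕ.^ (F.valuation ℕ.+ G.valuation) ℕ.* (F.unit ℕ.* G.unit) ∎
    ; p∤unit = ∤-* F.p∤unit G.p∤unit
    }
    where
    module F = Factorisation f
    module G = Factorisation g
    open ≡-Reasoning
    interchange : ∀ a b c d → a ℕ.* b ℕ.* (c ℕ.* d) ≡ a ℕ.* c ℕ.* (b ℕ.* d)
    interchange = ℕ.solve-∀

  factorise-acc : ∀ N → .{{NonZero N}} → Acc ℕ._<_ N → Factorisation N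
  factorise-acc N (acc rec) with p ℕ.∣? N
  ... | no p∤N = record { valuation = 0 ; unit = N ; N≡pᵛ*unit = sym (ℕ.*-identityˡ N) ; p∤unit = p∤N }
  ... | yes p∣N = subst Factorisation (sym (ℕ.m∣n⇒n≡m*quotient p∣N))
    (factorisation-* factorisation-p (factorise-acc (quotient p∣N) (rec (ℕ.quotient-< p∣N))))
    where
    instance
      quotient≢0 : NonZero (quotient p∣N)
      quotient≢0 = ℕ.quotient≢0 p∣N

  factorise : ∀ N → .{{NonZero N}} → Factorisation N
  factorise N = factorise-acc N (ℕ.<-wellFounded N)

  pᵛ*u-injective : ∀ v w {u x} → p ℕ.∤ u → p ℕ.∤ x → p ℕ.^ v ℕ.* u ≡ p ℕ.^ w ℕ.* x → v ≡ w × u ≡ x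
  pᵛ*u-injective zero    zero    {u} {x} _ _ eq =
    refl , trans (sym (ℕ.*-identityˡ u)) (trans eq (ℕ.*-identityˡ x))
  pᵛ*u-injective zero    (suc w) {u} {x} p∤u _ eq =
    contradiction (subst (p ℕ.∣_) (trans (sym eq) (ℕ.*-identityˡ u)) (ℕ.∣m⇒∣m*n x (ℕ.m∣m*n (p ℕ.^ w)))) p∤u
  pᵛ*u-injective (suc v) zero    {u} {x} _ p∤x eq =
    contradiction (subst (p ℕ.∣_) (trans eq (ℕ.*-identityˡ x)) (ℕ.∣m⇒∣m*n u (ℕ.m∣m*n (p ℕ.^ v)))) p∤x
  pᵛ*u-injective (suc v) (suc w) {u} {x} p∤u p∤x eq
    with pᵛ*u-injective v w p∤u p∤x
           (ℕ.*-cancelˡ-≡ _ _ p (trans (sym (ℕ.*-assoc p _ u)) (trans eq (ℕ.*-assoc p _ x))))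
  ... | refl , u≡x = refl , u≡x

  factorisation-unique : ∀ {N} (f g : Factorisation N) →
    Factorisation.valuation f ≡ Factorisation.valuation g × Factorisation.unit f ≡ Factorisation.unit g
  factorisation-unique f g =
    pᵛ*u-injective F.valuation G.valuation F.p∤unit G.p∤unit (trans (sym F.N≡pᵛ*unit) G.N≡pᵛ*unit)
    where
    module F = Factorisation f
    module G = Factorisation g

  p² : ℤ
  p² = + p * + p

  p*p∣n⇒p²∣n : ∀ {n} → p ℕ.* p ℕ.∣ n → p² ℤ.∣ + n
  p*p∣n⇒p²∣n {n} p*p∣n = ℤ.∣ᵤ⇒∣ (subst (ℕ._∣ n) (sym (ℤ.abs-* (+ p) (+ p))) p*p∣n)

  *-cancelˡ-mod : ∀ u {x y} → p ℕ.∤ u → + u * x ≡ + u * y mod p² → x ≡ y mod p²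
  *-cancelˡ-mod u {x} {y} p∤u (∣⇒≡-mod p²∣ux-uy) = ∣⇒≡-mod (ℤ.∣-trans (p*p∣n⇒p²∣n p²∣x-y) ℤ.∣m∣∣m)
    where
    factor : ∀ u x y → u * x - u * y ≡ u * (x - y)
    factor = solve-∀
    p²∣u*[x-y] : p ℕ.* p ℕ.∣ u ℕ.* ∣ x - y ∣
    p²∣u*[x-y] = subst₂ ℕ._∣_ (ℤ.abs-* (+ p) (+ p))
      (trans (cong ∣_∣ (factor (+ u) x y)) (ℤ.abs-* (+ u) (x - y))) (ℤ.∣⇒∣ᵤ p²∣ux-uy)
    p²∣x-y : p ℕ.* p ℕ.∣ ∣ x - y ∣
    p²∣x-y = p∤u∧p²∣u*w⇒p²∣w p∤u p²∣u*[x-y]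

  p*x≡p*y-mod⇒p∣x-y : ∀ {x y} → + p * x ≡ + p * y mod p² → + p ∣ x - y
  p*x≡p*y-mod⇒p∣x-y {x} {y} (∣⇒≡-mod p²∣px-py) =
    ℤ.∣⇒∣ᵤ (ℤ.*-cancelˡ-∣ (+ p) (subst (p² ℤ.∣_) (factor (+ p) x y) p²∣px-py))
    where
    factor : ∀ u x y → u * x - u * y ≡ u * (x - y)
    factor = solve-∀

  p∣p∂ : ∀ a → + p ℤ.∣ p∂ p a
  p∣p∂ a = ≡-mod⇒∣ (fermatsLittleTheorem p-prime a)

  open import Relation.Binary.Reasoning.Setoid (≡-mod-setoid p²)

  p∣a⇒p∂a≡a-mod : ∀ {a} → p ℕ.∣ a → p∂ p a ≡ + a mod p²
  p∣a⇒p∂a≡a-mod {a} p∣a = begin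
    p∂ p a                ≈⟨ n∣y⇒x≡x+y-mod (p*p∣n⇒p²∣n (d∣a⇒d*d∣aⁿ p>1 p∣a)) ⟩
    p∂ p a + + (a ℕ.^ p)  ≡⟨ cancel (+ a) (+ (a ℕ.^ p)) ⟩
    + a                   ∎
    where
    cancel : ∀ a x → a - x + x ≡ a
    cancel = solve-∀

  p∂-*-mod : ∀ a b → p∂ p (a ℕ.* b) ≡ + b * p∂ p a + + a * p∂ p b mod p²
  p∂-*-mod a b = begin
    p∂ p (a ℕ.* b)                    ≈⟨ n∣y⇒x≡x+y-mod (*-pres-∣ (p∣p∂ a) (p∣p∂ b)) ⟩
    p∂ p (a ℕ.* b) + p∂ p a * p∂ p b  ≡⟨ p∂-* p a b ⟩
    + b * p∂ p a + + a * p∂ p b       ∎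

  p∂-^ : ∀ a m → p∂ p (a ℕ.^ suc m) ≡ + suc m * + (a ℕ.^ m) * p∂ p a mod p²
  p∂-^ a zero    = ≡⇒≡-mod (trans (cong (p∂ p) (ℕ.*-identityʳ a)) (sym (ℤ.*-identityˡ (p∂ p a))))
  p∂-^ a (suc m) = begin
    p∂ p (a ℕ.* aᵐ⁺¹)
      ≈⟨ p∂-*-mod a aᵐ⁺¹ ⟩
    + aᵐ⁺¹ * p∂ p a + + a * p∂ p aᵐ⁺¹
      ≈⟨ +-congˡ-mod (+ aᵐ⁺¹ * p∂ p a) (*-congˡ-mod (+ a) (p∂-^ a m)) ⟩
    + aᵐ⁺¹ * p∂ p a + + a * (+ suc m * + (a ℕ.^ m) * p∂ p a)
      ≡⟨ cong (λ z → + aᵐ⁺¹ * p∂ p a + z) (reassoc (+ a) (+ suc m) (+ (a ℕ.^ m)) (p∂ p a)) ⟩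
    + aᵐ⁺¹ * p∂ p a + + suc m * (+ a * + (a ℕ.^ m)) * p∂ p a
      ≡⟨ cong (λ z → + aᵐ⁺¹ * p∂ p a + + suc m * z * p∂ p a) (ℤ.pos-* a (a ℕ.^ m)) ⟨
    + aᵐ⁺¹ * p∂ p a + + suc m * + aᵐ⁺¹ * p∂ p a
      ≡⟨ collect (+ aᵐ⁺¹) (+ suc m) (p∂ p a) ⟩
    (+ 1 + + suc m) * + aᵐ⁺¹ * p∂ p a ∎
    where
    aᵐ⁺¹ : ℕ
    aᵐ⁺¹ = a ℕ.^ suc m
    reassoc : ∀ A M X d → A * (M * X * d) ≡ M * (A * X) * d
    reassoc = solve-∀
    collect : ∀ X M d → X * d + M * X * d ≡ (+ 1 + M) * X * d
    collect = solve-∀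

  -- S stands for D(N)/N with D = p∂ p, multiplied through by the unit part of N to avoid division.
  record LogDerivative (N : ℕ) (S : ℤ) : Set where
    field
      factorisation : Factorisation N
    open Factorisation factorisation public
    field
      congruence : + unit * S ≡ + valuation * + unit + p∂ p unit mod p²

  logDerivative-1 : LogDerivative 1 (+ 0)
  logDerivative-1 = record
    { factorisation = factorisation-1
    ; congruence = ≡⇒≡-mod (sym (trans (ℤ.+-identityˡ (p∂ p 1)) (p∂-1 p)))
    }

  logDerivative-* : ∀ {M N S T} → LogDerivative M S → LogDerivative N T → LogDerivative (M ℕ.* N) (S + T)
  logDerivative-* {S = S} {T} f g = record
    { factorisation = factorisation-* F.factorisation G.factorisation
    ; congruence = begin
        + (u ℕ.* w) * (S + T)
          ≡⟨ cong (_* (S + T)) (ℤ.pos-* u w) ⟩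
        + u * + w * (S + T)
          ≡⟨ spread (+ u) (+ w) S T ⟩
        + w * (+ u * S) + + u * (+ w * T)
          ≈⟨ +-cong-mod (*-congˡ-mod (+ w) F.congruence) (*-congˡ-mod (+ u) G.congruence) ⟩
        + w * (+ v * + u + p∂ p u) + + u * (+ x * + w + p∂ p w)
          ≡⟨ collect (+ u) (+ w) (+ v) (+ x) (p∂ p u) (p∂ p w) ⟩
        (+ v + + x) * (+ u * + w) + (+ w * p∂ p u + + u * p∂ p w)
          ≈⟨ +-congˡ-mod ((+ v + + x) * (+ u * + w)) (≡-mod-sym (p∂-*-mod u w)) ⟩
        (+ v + + x) * (+ u * + w) + p∂ p (u ℕ.* w)
          ≡⟨ cong₂ (λ s t → s * t + p∂ p (u ℕ.* w)) (ℤ.pos-+ v x) (ℤ.pos-* u w) ⟨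
        + (v ℕ.+ x) * + (u ℕ.* w) + p∂ p (u ℕ.* w) ∎
    }
    where
    module F = LogDerivative f
    module G = LogDerivative g
    u v w x : ℕ
    u = F.unit
    v = F.valuation
    w = G.unit
    x = G.valuation
    spread : ∀ u w S T → u * w * (S + T) ≡ w * (u * S) + u * (w * T)
    spread = solve-∀
    collect : ∀ u w v x du dw → w * (v * u + du) + u * (x * w + dw) ≡ (v + x) * (u * w) + (w * du + u * dw)
    collect = solve-∀

  logDerivative-unique : ∀ {N S T} → LogDerivative N S → LogDerivative N T → S ≡ T mod p²
  logDerivative-unique {S = S} {T} f g = *-cancelˡ-mod F.unit F.p∤unit (begin
    + F.unit * S                            ≈⟨ F.congruence ⟩
    + F.valuation * + F.unit + p∂ p F.unit  ≡⟨ cong₂ (λ v u → + v * + u + p∂ p u) (proj₁ same) (proj₂ same) ⟩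
    + G.valuation * + G.unit + p∂ p G.unit  ≈⟨ G.congruence ⟨
    + G.unit * T                            ≡⟨ cong (λ u → + u * T) (proj₂ same) ⟨
    + F.unit * T                            ∎)
    where
    module F = LogDerivative f
    module G = LogDerivative g
    same : F.valuation ≡ G.valuation × F.unit ≡ G.unit
    same = factorisation-unique F.factorisation G.factorisation

  logDerivative-selfPow-coprime : ∀ a → p ℕ.∤ a → LogDerivative (a ℕ.^ a) (p∂ p a)
  logDerivative-selfPow-coprime zero    p∤0 = contradiction (p ℕ.∣0) p∤0
  logDerivative-selfPow-coprime (suc a) p∤a = record
    { factorisation = record
        { valuation = 0 ; unit = A ; N≡pᵛ*unit = sym (ℕ.*-identityˡ A) ; p∤unit = ∤-^ p∤a (suc a) }
    ; congruence = begin
        + A * p∂ p (suc a)                        ≡⟨ cong (_* p∂ p (suc a)) (ℤ.pos-* (suc a) (suc a ℕ.^ a)) ⟩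
        + suc a * + (suc a ℕ.^ a) * p∂ p (suc a)  ≈⟨ p∂-^ (suc a) a ⟨
        p∂ p A                                    ≡⟨ ℤ.+-identityˡ (p∂ p A) ⟨
        + 0 * + A + p∂ p A                        ∎
    }
    where
    A : ℕ
    A = suc a ℕ.^ suc a

  logDerivative-selfPow-multiple : ∀ a k {u} → suc a ≡ p ℕ.^ suc k ℕ.* u → p ℕ.∤ u →
    LogDerivative (suc a ℕ.^ suc a) (p∂ p (suc a))
  logDerivative-selfPow-multiple a k {u} a≡pᵏ⁺¹u p∤u = record
    { factorisation = record
        { valuation = suc k ℕ.* A ; unit = U ; N≡pᵛ*unit = Aᴬ≡pᵛU ; p∤unit = ∤-^ p∤u A }
    ; congruence = begin
        + U * p∂ p A                   ≈⟨ *-congˡ-mod (+ U) (p∣a⇒p∂a≡a-mod p∣A) ⟩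
        + U * + A                      ≈⟨ n∣y⇒x≡x+y-mod (ℤ.∣m⇒∣m*n (+ U) (p*p∣n⇒p²∣n p²∣kA)) ⟩
        + U * + A + + (k ℕ.* A) * + U  ≡⟨ collect (+ U) (+ A) (+ (k ℕ.* A)) ⟩
        (+ A + + (k ℕ.* A)) * + U      ≡⟨ cong (_* + U) (ℤ.pos-+ A (k ℕ.* A)) ⟨
        + (suc k ℕ.* A) * + U          ≡⟨ ℤ.+-identityʳ _ ⟨
        + (suc k ℕ.* A) * + U + + 0    ≈⟨ +-congˡ-mod (+ (suc k ℕ.* A) * + U) (≡-mod-sym p∂U≡0) ⟩
        + (suc k ℕ.* A) * + U + p∂ p U ∎
    }
    where
    A U : ℕ
    A = suc a
    U = u ℕ.^ A
    Aᴬ≡pᵛU : A ℕ.^ A ≡ p ℕ.^ (suc k ℕ.* A) ℕ.* U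
    Aᴬ≡pᵛU = trans (cong (ℕ._^ A) a≡pᵏ⁺¹u)
      (trans (^-distribʳ-* (p ℕ.^ suc k) u A) (cong (ℕ._* U) (ℕ.^-*-assoc p (suc k) A)))
    p∣A : p ℕ.∣ A
    p∣A = subst (p ℕ.∣_) (sym a≡pᵏ⁺¹u) (ℕ.∣m⇒∣m*n u (ℕ.m∣m*n (p ℕ.^ k)))
    p²∣kA : p ℕ.* p ℕ.∣ k ℕ.* A
    p²∣kA = subst (λ z → p ℕ.* p ℕ.∣ k ℕ.* z) (sym a≡pᵏ⁺¹u)
      (subst (p ℕ.* p ℕ.∣_) (ℕ.*-assoc k _ u) (ℕ.∣m⇒∣m*n u (d*d∣k*dᵏ⁺¹ p k)))
    p∂U≡0 : p∂ p U ≡ + 0 mod p²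
    p∂U≡0 = ≡-mod-trans (p∂-^ u a)
      (∣⇒≡0-mod (*-pres-∣ {+ p} {+ p} (ℤ.∣m⇒∣m*n (+ (u ℕ.^ a)) (ℤ.∣ᵤ⇒∣ {+ p} {+ A} p∣A)) (p∣p∂ u)))
    collect : ∀ U A K → U * A + K * U ≡ (A + K) * U
    collect = solve-∀

  logDerivative-selfPow : ∀ a → LogDerivative (a ℕ.^ a) (p∂ p a)
  logDerivative-selfPow zero    = subst (LogDerivative 1) (sym (p∂-0 p)) logDerivative-1
  logDerivative-selfPow (suc a) with factorise (suc a)
  ... | record { valuation = zero ; unit = u ; N≡pᵛ*unit = a≡u ; p∤unit = p∤u } =
    logDerivative-selfPow-coprime (suc a) (subst (p ℕ.∤_) (sym (trans a≡u (ℕ.*-identityˡ u))) p∤u)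
  ... | record { valuation = suc k ; N≡pᵛ*unit = a≡pᵏ⁺¹u ; p∤unit = p∤u } =
    logDerivative-selfPow-multiple a k a≡pᵏ⁺¹u p∤u

  logDerivative-selfPowProd : ∀ {n} (a : Fin n → ℕ) → LogDerivative (selfPowProd a) (sumℤ (λ i → p∂ p (a i)))
  logDerivative-selfPowProd {zero}  a = logDerivative-1
  logDerivative-selfPowProd {suc n} a =
    logDerivative-* (logDerivative-selfPow (a Fin.zero)) (logDerivative-selfPowProd (a ∘ Fin.suc))

p∂≡p*∂ : ∀ {p} .{{_ : NonZero p}} → Prime p → ∀ a → p∂ p a ≡ + p * ∂ p a
p∂≡p*∂ {p} p-prime a = trans (∣⇒n≡[n/ℕd]*d (p∣p∂ p-prime a)) (ℤ.*-comm (p∂ p a /ℕ p) (+ p))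

sumℤ-p∂≡p*sumℤ-∂ : ∀ {p} .{{_ : NonZero p}} → Prime p → ∀ {n} (a : Fin n → ℕ) →
  sumℤ (λ i → p∂ p (a i)) ≡ + p * sumℤ (λ i → ∂ p (a i))
sumℤ-p∂≡p*sumℤ-∂ {p} p-prime a = *-distribˡ-sumℤ (+ p) _ _ (p∂≡p*∂ p-prime ∘ a)

lemma7p1 : (p : ℕ) → .{{_ : NonZero p}} → Prime p → (n m : ℕ) → n ≥ 1 → m ≥ 1
    → (a : Fin n → ℕ) → (b : Fin m → ℕ)
    → selfPowProd a ≡ selfPowProd b
    → (+ p) ∣ (sumℤ (λ i → ∂ p (a i)) - sumℤ (λ j → ∂ p (b j)))
lemma7p1 p p-prime _ _ _ _ a b same-product = p*x≡p*y-mod⇒p∣x-y p-prime (begin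
  + p * sumℤ (λ i → ∂ p (a i))  ≡⟨ sumℤ-p∂≡p*sumℤ-∂ p-prime a ⟨
  sumℤ (λ i → p∂ p (a i))       ≈⟨ logDerivative-unique p-prime log-a log-b ⟩
  sumℤ (λ j → p∂ p (b j))       ≡⟨ sumℤ-p∂≡p*sumℤ-∂ p-prime b ⟩
  + p * sumℤ (λ j → ∂ p (b j))  ∎)
  where
  open import Relation.Binary.Reasoning.Setoid (≡-mod-setoid (p² p-prime))
  log-a : LogDerivative p-prime (selfPowProd b) (sumℤ (λ i → p∂ p (a i)))
  log-a = subst (λ N → LogDerivative p-prime N _) same-product (logDerivative-selfPowProd p-prime a)
  log-b : LogDerivative p-prime (selfPowProd b) (sumℤ (λ j → p∂ p (b j)))
  log-b = logDerivative-selfPowProd p-prime b
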